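{- Let the rooted trees $T_i^j$ and their proper colorings $f_i^j$, for $(i,j)\in\mathbb{N}\times\mathbb{N}$, be defined as in the context below. Then for every $(i,j)\in\mathbb{N}\times\mathbb{N}$: (1) If $f'$ is a proper coloring of $T_i^j$ different from $f_i^j$, then $\Sigma f'>\Sigma f_i^j$. Furthermore, if $f'$ assigns to the root of $T_i^j$ a color different from $i$, then $\Sigma f'-\Sigma f_i^j\ge j$. (2) If $j=1$, then $\Delta(T_i^j)=2i-2$, and this maximum degree is achieved by the root of $T_i^j$. If $j\ge 2$, then $\Delta(T_i^j)=2(i+j)-3$. (3) The highest color used by $f_i^j$ is $i+j-1$.
   Context: $\mathbb{N}=\{1,2,\dots\}$. A proper coloring of a graph $G$ is a function $f\colon V(G)\to\mathbb{N}$ such that adjacent vertices receive different values (colors); for a coloring $f$ of a tree $T$, $\Sigma f=\sum_{v\in V(T)} f(v)$. $\Delta(G)$ denotes the maximum degree of $G$. Linearly order $\mathbb{N}\times\mathbb{N}$ by $(h,l)<(i,j)$ if either $h+l<i+j$, or $h+l=i+j$ and $l<j$. Following this order, rooted trees $T_i^j$ and colorings $f_i^j$ are defined inductively: $T_1^1$ is a single vertex (its root) and $f_1^1$ gives it color $1$. For $(i,j)\neq(1,1)$, $T_i^j$ has a root $u$; for each integer $k$ with $1\le k\le i+j-1$ and $k\neq i$, take two copies of $T_k^m$ where $m=\lceil (i+j-k)/2\rceil$, and make the roots of these $2(i+j-2)$ trees children of $u$. The coloring $f_i^j$ assigns $i$ to $u$ and uses $f_k^m$ on each copy of $T_k^m$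 attached below $u$. -}

module Defs where

open import Data.Nat using (ℕ; zero; suc; _+_; _*_; _∸_; _≤_; _⊔_; ⌈_/2⌉; _≡ᵇ_)
open import Data.Bool using (Bool; true; false; if_then_else_)
open import Data.List using (List; []; _∷_; length; applyUpTo; concatMap)
open import Data.List.Relation.Unary.All using (All)
open import Data.Unit using (⊤; tt)
open import Relation.Binary.PropositionalEquality using (_≢_)

-- Finite rooted (unordered in spirit; children stored as a list) trees
-- with a label at every vertex.
data Tree (A : Set) : Set where
  node : A → List (Tree A) → Tree A

label : ∀ {A} → Tree A → A
label (node a _) = a

children : ∀ {A} → Tree A → List (Tree A)
children (node _ ts) = ts

Shape : Set
Shape = Tree ⊤

mutual
  shape : ∀ {A} → Tree A → Shape
  shape (node _ ts) = node tt (shapes ts)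

  shapes : ∀ {A} → List (Tree A) → List Shape
  shapes []       = []
  shapes (t ∷ ts) = shape t ∷ shapes ts

-- A coloring of a shape T is a labelled tree c (labels in ℕ) with shape c ≡ T.
-- It is proper (with colors in ℕ = {1,2,...}) if every color is ≥ 1 and
-- every vertex's color differs from each of its children's colors
-- (the edges of a rooted tree are exactly the parent–child pairs).
data Proper : Tree ℕ → Set where
  node : ∀ {c ts} → 1 ≤ c → All (λ t → label t ≢ c) ts → All Proper ts →
         Proper (node c ts)

mutual
  colorSum : Tree ℕ → ℕ
  colorSum (node c ts) = c + colorSums ts

  colorSums : List (Tree ℕ) → ℕ
  colorSums []       = 0
  colorSums (t ∷ ts) = colorSum t + colorSums ts

mutual
  maxColor : Tree ℕ → ℕ
  maxColor (node c ts) = c ⊔ maxColors ts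

  maxColors : List (Tree ℕ) → ℕ
  maxColors []       = 0
  maxColors (t ∷ ts) = maxColor t ⊔ maxColors ts

-- Degrees: the root has degree = number of children; a non-root vertex
-- has degree = number of children + 1 (its parent).
rootDegree : ∀ {A} → Tree A → ℕ
rootDegree t = length (children t)

mutual
  maxDegBelow : ∀ {A} → Tree A → ℕ
  maxDegBelow (node _ ts) = suc (length ts) ⊔ maxDegBelows ts

  maxDegBelows : ∀ {A} → List (Tree A) → ℕ
  maxDegBelows []       = 0
  maxDegBelows (t ∷ ts) = maxDegBelow t ⊔ maxDegBelows ts

Δ : ∀ {A} → Tree A → ℕ
Δ (node _ ts) = length ts ⊔ maxDegBelows ts

build : ℕ → ℕ → ℕ → Tree ℕ
build zero    i j = node i []
build (suc n) i j =
  node i (concatMap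
            (λ k → if k ≡ᵇ i then []
                   else (build n k ⌈ (i + j ∸ k) /2⌉ ∷ build n k ⌈ (i + j ∸ k) /2⌉ ∷ []))
            (applyUpTo suc (i + j ∸ 1)))

-- Fuel (i+j)^2 + j strictly decreases along the well-founded order used
-- in the paper's inductive definition, so it is always sufficient.
fuel : ℕ → ℕ → ℕ
fuel i j = (i + j) * (i + j) + j

f : ℕ → ℕ → Tree ℕ
f i j = build (fuel i j) i j

T : ℕ → ℕ → Shape
T i j = shape (f i j)

{-# OPTIONS --safe #-}
module Submission where

-- Below the root of T_i^j sit
-- two copies of T_k^m for every k < i + j other than i, where m = ⌈(i + j − k)/2⌉, so that
-- k + m ≤ i + j ≤ k + 2m.
--
-- A proper colouring with root colour i costs i plus the costs of proper
-- colourings of the subtrees, so by induction it is f i j or strictly dearer.  A root colour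
-- c ≥ i + j costs at least j more at the root alone.  A root colour c < i + j, c ≠ i, equals
-- the root colour of two copies of T_c^m, which must therefore be recoloured at their roots;
-- by induction each then costs at least m more, and 2m ≥ i + j − c.
--
-- A copy of T_k^m has colours below k + m ≤ i + j and maximum degree
-- 2(k + m) − 3 ≤ 2(i + j) − 3 (counting the edge to its parent), while the root of T_i^j has
-- 2(i + j − 2) children.  For j ≥ 2 the child k = i + j − 1 (with m = 1) attains both bounds;
-- for j = 1 every child has k + m < i + j, so the root is a vertex of maximum degree and
-- the top colour i sits at the root.

open import Defs
open import Data.Nat
  using (ℕ; zero; suc; _+_; _*_; _∸_; _≤_; _<_; _⊔_; ⌈_/2⌉; ⌊_/2⌋; _≡ᵇ_; _≟_; _≤?_; z≤n; s≤s; z<s)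
open import Data.Nat.Properties
open import Data.Bool using (if_then_else_)
open import Data.List using (List; []; _∷_; _++_; length; map; filter; applyUpTo; concatMap)
open import Data.List.Properties
  using (length-++; filter-++; filter-accept; filter-reject; filter-none; applyUpTo-∷ʳ; length-applyUpTo; ∷-injective)
open import Data.List.Membership.Propositional using (_∈_)
open import Data.List.Membership.Propositional.Properties using (∈-applyUpTo⁺; ∈-map⁺; ∈-concat⁺′)
open import Data.List.Relation.Unary.All using (All; []; _∷_)
import Data.List.Relation.Unary.All.Properties as All
open import Data.List.Relation.Unary.Any using (here; there)
open import Data.Product using (_×_; _,_)
open import Data.Sum using (_⊎_; inj₁; inj₂)
open import Function using (_∘_; flip)
open import Level using (0ℓ)
open import Relation.Nullary using (¬_; Dec; yes; no; contradiction)
open import Relation.Nullary.Decidable using (dec-true; dec-false)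
open import Relation.Unary using (Pred; Decidable)
open import Relation.Binary.PropositionalEquality
open import Algebra.Properties.CommutativeSemigroup +-commutativeSemigroup
  using (x∙yz≈y∙xz; xy∙z≈xz∙y; interchange)

n≤2*⌈n/2⌉ : ∀ n → n ≤ 2 * ⌈ n /2⌉
n≤2*⌈n/2⌉ n = begin
  n                  ≡⟨ ⌊n/2⌋+⌈n/2⌉≡n n ⟨
  ⌊ n /2⌋ + ⌈ n /2⌉  ≤⟨ +-monoˡ-≤ ⌈ n /2⌉ (⌊n/2⌋≤⌈n/2⌉ n) ⟩
  ⌈ n /2⌉ + ⌈ n /2⌉  ≡⟨ cong (⌈ n /2⌉ +_) (+-identityʳ ⌈ n /2⌉) ⟨
  2 * ⌈ n /2⌉        ∎
  where open ≤-Reasoning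

⌈n/2⌉≡n⇒n≤1 : ∀ n → ⌈ n /2⌉ ≡ n → n ≤ 1
⌈n/2⌉≡n⇒n≤1 zero          _ = z≤n
⌈n/2⌉≡n⇒n≤1 (suc zero)    _ = ≤-refl
⌈n/2⌉≡n⇒n≤1 (suc (suc n)) e = contradiction e (<⇒≢ (⌈n/2⌉<n n))

m≤m+n∸1 : ∀ m {n} → 1 ≤ n → m ≤ m + n ∸ 1
m≤m+n∸1 m {n} 1≤n = ≤-trans (m≤m+n m (n ∸ 1)) (≤-reflexive (sym (+-∸-assoc m 1≤n)))

m<n∸1⇒1+m<n : ∀ {m n} → m < n ∸ 1 → suc m < n
m<n∸1⇒1+m<n {n = suc n} m<n = s≤s m<n

+-≤-tight : ∀ {a a' b b'} → a ≤ a' → b ≤ b' → a' + b' ≡ a + b → a' ≡ a × b' ≡ b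
+-≤-tight {a} {a'} {b} {b'} a≤a' b≤b' e =
  a'≡a , +-cancelˡ-≡ a b' b (subst (λ x → x + b' ≡ a + b) a'≡a e)
  where
  a'≡a : a' ≡ a
  a'≡a = ≤-antisym (+-cancelʳ-≤ b a' a (≤-trans (+-monoʳ-≤ a' b≤b') (≤-reflexive e))) a≤a'

count : {A : Set} {P : Pred A 0ℓ} → Decidable P → List A → ℕ
count P? xs = length (filter P? xs)

module _ {A : Set} {P : Pred A 0ℓ} (P? : Decidable P) where

  count-++ : ∀ xs ys → count P? (xs ++ ys) ≡ count P? xs + count P? ys
  count-++ xs ys = trans (cong length (filter-++ P? xs ys)) (length-++ (filter P? xs))

  count-accept : ∀ x xs → P x → count P? (x ∷ xs) ≡ suc (count P? xs)
  count-accept x xs px = cong length (filter-accept P? {x} {xs} px)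

  count-reject : ∀ x xs → ¬ P x → count P? (x ∷ xs) ≡ count P? xs
  count-reject x xs ¬px = cong length (filter-reject P? {x} {xs} ¬px)

  count-concatMap-∈ : ∀ {B : Set} (g : B → List A) {x xs} → x ∈ xs →
                      count P? (g x) ≤ count P? (concatMap g xs)
  count-concatMap-∈ g {xs = y ∷ ys} x∈xs =
    ≤-trans (here-or-there x∈xs) (≤-reflexive (sym (count-++ (g y) (concatMap g ys))))
    where
    here-or-there : ∀ {x} → x ∈ y ∷ ys → count P? (g x) ≤ count P? (g y) + count P? (concatMap g ys)
    here-or-there (here refl)  = m≤m+n _ _
    here-or-there (there x∈ys) = ≤-trans (count-concatMap-∈ g x∈ys) (m≤n+m _ _)

count-upTo-< : ∀ {i} N → N < i → count (_≟ i) (applyUpTo suc N) ≡ 0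
count-upTo-< {i} N N<i =
  cong length (filter-none (_≟ i) (All.applyUpTo⁺₁ suc N λ x<N → <⇒≢ (≤-<-trans x<N N<i)))

count-upTo-≤ : ∀ {i} N → 1 ≤ i → i ≤ N → count (_≟ i) (applyUpTo suc N) ≡ 1
count-upTo-≤     zero    1≤i i≤0   = contradiction i≤0 (<⇒≱ 1≤i)
count-upTo-≤ {i} (suc N) 1≤i i≤1+N = begin
  count (_≟ i) (applyUpTo suc (suc N))                         ≡⟨ cong (count (_≟ i)) (applyUpTo-∷ʳ suc N) ⟨
  count (_≟ i) (applyUpTo suc N ++ suc N ∷ [])                 ≡⟨ count-++ (_≟ i) (applyUpTo suc N) (suc N ∷ []) ⟩
  count (_≟ i) (applyUpTo suc N) + count (_≟ i) (suc N ∷ [])   ≡⟨ last-or-not (m≤n⇒m<n∨m≡n i≤1+N) ⟩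
  1                                                            ∎
  where
  open ≡-Reasoning
  last-or-not : i < suc N ⊎ i ≡ suc N → count (_≟ i) (applyUpTo suc N) + count (_≟ i) (suc N ∷ []) ≡ 1
  last-or-not (inj₁ i<1+N)
    rewrite count-upTo-≤ N 1≤i (m<1+n⇒m≤n i<1+N) | dec-false (suc N ≟ i) (>⇒≢ i<1+N) = refl
  last-or-not (inj₂ refl)
    rewrite count-upTo-< N (n<1+n N) | dec-true (suc N ≟ suc N) refl = refl

_≺_ : ℕ × ℕ → ℕ × ℕ → Set
(h , l) ≺ (i , j) = h + l < i + j ⊎ (h + l ≡ i + j × l < j)

fuel-< : ∀ {h l i j} → (h , l) ≺ (i , j) → fuel h l < fuel i j
fuel-< {h} {l} {i} {j} (inj₁ p<s) = begin-strict
  p * p + l      ≤⟨ +-monoʳ-≤ (p * p) (m≤n+m l h) ⟩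
  p * p + p      ≡⟨ +-comm (p * p) p ⟩
  p + p * p      ≡⟨ *-suc p p ⟨
  p * suc p      <⟨ m<n+m (p * suc p) z<s ⟩
  suc p * suc p  ≤⟨ *-mono-≤ p<s p<s ⟩
  s * s          ≤⟨ m≤m+n (s * s) j ⟩
  s * s + j      ∎
  where
  open ≤-Reasoning
  p = h + l
  s = i + j
fuel-< {i = i} {j} (inj₂ (p≡s , l<j)) rewrite p≡s = +-monoʳ-< ((i + j) * (i + j)) l<j

childSup : ℕ → ℕ → ℕ → ℕ
childSup i j k = ⌈ (i + j ∸ k) /2⌉

child : ℕ → ℕ → ℕ → ℕ → Tree ℕ
child n i j k = build n k (childSup i j k)

record ChildIndex (i j k : ℕ) : Set where
  field
    1≤k   : 1 ≤ k
    k<i+j : k < i + j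
    k≢i   : k ≢ i

module _ {i j k : ℕ} (κ : ChildIndex i j k) where
  open ChildIndex κ

  private
    d = i + j ∸ k

    k+d≡i+j : k + d ≡ i + j
    k+d≡i+j = m+[n∸m]≡n (<⇒≤ k<i+j)

  childSup-positive : 1 ≤ childSup i j k
  childSup-positive = ⌈n/2⌉-mono (m<n⇒0<n∸m k<i+j)

  child-sum-≤ : k + childSup i j k ≤ i + j
  child-sum-≤ = ≤-trans (+-monoʳ-≤ k (⌈n/2⌉≤n d)) (≤-reflexive k+d≡i+j)

  child-sum-gap : i + j ≤ k + 2 * childSup i j k
  child-sum-gap = ≤-trans (≤-reflexive (sym k+d≡i+j)) (+-monoʳ-≤ k (n≤2*⌈n/2⌉ d))

  -- k + m = i + j forces m = 1, i.e. k = i + j − 1, and then j = 1 would give k = i.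
  child-≺ : 1 ≤ j → (k , childSup i j k) ≺ (i , j)
  child-≺ 1≤j with m≤n⇒m<n∨m≡n child-sum-≤
  ... | inj₁ k+m<i+j = inj₁ k+m<i+j
  ... | inj₂ k+m≡i+j = inj₂ (k+m≡i+j , ≤-<-trans m≤1 (≤∧≢⇒< 1≤j (j≢1 ∘ sym)))
    where
    m = childSup i j k
    m≤1 : m ≤ 1
    m≤1 = ≤-trans (⌈n/2⌉≤n d) (⌈n/2⌉≡n⇒n≤1 d (+-cancelˡ-≡ k m d (trans k+m≡i+j (sym k+d≡i+j))))
    j≢1 : j ≢ 1
    j≢1 j≡1 = k≢i (+-cancelʳ-≡ 1 k i (begin
      k + 1  ≡⟨ cong (k +_) (≤-antisym childSup-positive m≤1) ⟩
      k + m  ≡⟨ k+m≡i+j ⟩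
      i + j  ≡⟨ cong (i +_) j≡1 ⟩
      i + 1  ∎))
      where open ≡-Reasoning

child-sum-≤-when-j≡1 : ∀ {i k} → ChildIndex i 1 k → k + childSup i 1 k ≤ i
child-sum-≤-when-j≡1 {i} {k} κ with child-≺ κ ≤-refl
... | inj₁ k+m<i+1   = m<1+n⇒m≤n (subst (k + childSup i 1 k <_) (+-comm i 1) k+m<i+1)
... | inj₂ (_ , m<1) = contradiction (childSup-positive κ) (<⇒≱ m<1)

module _ {i j : ℕ} (2≤j : 2 ≤ j) where

  private
    1+[i+j∸1]≡i+j : suc (i + j ∸ 1) ≡ i + j
    1+[i+j∸1]≡i+j = m+[n∸m]≡n (≤-trans (≤-trans (s≤s z≤n) 2≤j) (m≤n+m j i))

  lastChild : ChildIndex i j (i + j ∸ 1)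
  lastChild = record
    { 1≤k   = ≤-pred (≤-trans 2≤j (≤-trans (m≤n+m j i) (≤-reflexive (sym 1+[i+j∸1]≡i+j))))
    ; k<i+j = ≤-reflexive 1+[i+j∸1]≡i+j
    ; k≢i   = λ k≡i → <-irrefl (trans (cong suc (sym k≡i)) 1+[i+j∸1]≡i+j)
                               (≤-<-trans (≤-reflexive (+-comm 1 i)) (+-monoʳ-< i 2≤j))
    }

  lastChild-sum : i + j ≤ (i + j ∸ 1) + childSup i j (i + j ∸ 1)
  lastChild-sum = begin
    i + j                                   ≡⟨ 1+[i+j∸1]≡i+j ⟨
    suc (i + j ∸ 1)                         ≡⟨ +-comm 1 (i + j ∸ 1) ⟩
    (i + j ∸ 1) + 1                         ≤⟨ +-monoʳ-≤ (i + j ∸ 1) (childSup-positive lastChild) ⟩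
    (i + j ∸ 1) + childSup i j (i + j ∸ 1)  ∎
    where open ≤-Reasoning

record Fueled (n i j : ℕ) : Set where
  field
    1≤i    : 1 ≤ i
    1≤j    : 1 ≤ j
    enough : fuel i j ≤ n

¬Fueled-zero : ∀ {i j} → ¬ Fueled 0 i j
¬Fueled-zero {i} {j} φ = contradiction (≤-trans (≤-trans 1≤j (m≤n+m j _)) enough) (λ ())
  where open Fueled φ

Fueled-child : ∀ {n i j k} → Fueled (suc n) i j → ChildIndex i j k → Fueled n k (childSup i j k)
Fueled-child φ κ = record
  { 1≤i    = ChildIndex.1≤k κ
  ; 1≤j    = childSup-positive κ
  ; enough = ≤-pred (≤-trans (fuel-< (child-≺ κ (Fueled.1≤j φ))) (Fueled.enough φ))
  }

label-build : ∀ n i j → label (build n i j) ≡ i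
label-build zero    i j = refl
label-build (suc n) i j = refl

-- kids n i j is definitionally the list of children of build (suc n) i j.
kidsAt : ℕ → ℕ → ℕ → ℕ → List (Tree ℕ)
kidsAt n i j k = if k ≡ᵇ i then [] else child n i j k ∷ child n i j k ∷ []

kids : ℕ → ℕ → ℕ → List (Tree ℕ)
kids n i j = concatMap (kidsAt n i j) (applyUpTo suc (i + j ∸ 1))

kidsAt-self : ∀ n i j → kidsAt n i j i ≡ []
kidsAt-self n i j rewrite dec-true (i ≟ i) refl = refl

kidsAt-≢ : ∀ n i j {k} → k ≢ i → kidsAt n i j k ≡ child n i j k ∷ child n i j k ∷ []
kidsAt-≢ n i j {k} k≢i rewrite dec-false (k ≟ i) k≢i = refl

module _ {n i j : ℕ} where

  kids-All : {P : Pred (Tree ℕ) 0ℓ} → (∀ {k} → ChildIndex i j k → P (child n i j k)) → All P (kids n i j)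
  kids-All {P} P-child =
    All.concat⁺ (All.map⁺ (All.applyUpTo⁺₁ suc (i + j ∸ 1) (kidsAt-All (s≤s z≤n) ∘ m<n∸1⇒1+m<n)))
    where
    kidsAt-All : ∀ {k} → 1 ≤ k → k < i + j → All P (kidsAt n i j k)
    kidsAt-All {k} 1≤k k<i+j with k ≟ i
    ... | yes refl rewrite kidsAt-self n i j = []
    ... | no k≢i   rewrite kidsAt-≢ n i j k≢i = P-k ∷ P-k ∷ []
      where
      P-k : P (child n i j k)
      P-k = P-child (record { 1≤k = 1≤k ; k<i+j = k<i+j ; k≢i = k≢i })

  private
    range-∈ : ∀ {k} → ChildIndex i j k → k ∈ applyUpTo suc (i + j ∸ 1)
    range-∈ {suc k} κ = ∈-applyUpTo⁺ suc (suc[m]≤n⇒m≤pred[n] (ChildIndex.k<i+j κ))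

  kids-∈ : ∀ {k} → ChildIndex i j k → child n i j k ∈ kids n i j
  kids-∈ {k} κ = ∈-concat⁺′ child∈kidsAt (∈-map⁺ (kidsAt n i j) (range-∈ κ))
    where
    child∈kidsAt : child n i j k ∈ kidsAt n i j k
    child∈kidsAt rewrite kidsAt-≢ n i j (ChildIndex.k≢i κ) = here refl

  count-kids : ∀ {c} → ChildIndex i j c → 2 ≤ count (λ t → label t ≟ c) (kids n i j)
  count-kids {c} κ = ≤-trans (≤-reflexive (sym two)) (count-concatMap-∈ P? (kidsAt n i j) (range-∈ κ))
    where
    P? = λ t → label t ≟ c
    copy = child n i j c
    two : count P? (kidsAt n i j c) ≡ 2
    two rewrite kidsAt-≢ n i j (ChildIndex.k≢i κ) =
      trans (count-accept P? copy (copy ∷ []) copy≡c) (cong suc (count-accept P? copy [] copy≡c))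
      where
      copy≡c : label copy ≡ c
      copy≡c = label-build n c (childSup i j c)

  private
    length-concatMap-kidsAt : ∀ ks → length (concatMap (kidsAt n i j) ks) + 2 * count (_≟ i) ks ≡ 2 * length ks
    length-concatMap-kidsAt [] = refl
    length-concatMap-kidsAt (k ∷ ks) with k ≟ i
    ... | yes refl rewrite kidsAt-self n i j | dec-true (i ≟ i) refl = begin
      a + 2 * suc c    ≡⟨ cong (a +_) (*-suc 2 c) ⟩
      a + (2 + 2 * c)  ≡⟨ x∙yz≈y∙xz a 2 (2 * c) ⟩
      2 + (a + 2 * c)  ≡⟨ cong (2 +_) (length-concatMap-kidsAt ks) ⟩
      2 + 2 * l        ≡⟨ *-suc 2 l ⟨
      2 * suc l        ∎
      where
      open ≡-Reasoning
      a = length (concatMap (kidsAt n i j) ks)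
      c = count (_≟ i) ks
      l = length ks
    ... | no k≢i   rewrite kidsAt-≢ n i j k≢i | dec-false (k ≟ i) k≢i =
      trans (cong (2 +_) (length-concatMap-kidsAt ks)) (sym (*-suc 2 (length ks)))

  length-kids : 1 ≤ i → 1 ≤ j → 4 + length (kids n i j) ≡ 2 * (i + j)
  length-kids 1≤i 1≤j = begin
    4 + L                          ≡⟨ cong (2 +_) (+-comm 2 L) ⟩
    2 + (L + 2)                    ≡⟨ cong (λ c → 2 + (L + 2 * c)) i-once ⟨
    2 + (L + 2 * count (_≟ i) ks)  ≡⟨ cong (2 +_) (length-concatMap-kidsAt ks) ⟩
    2 + 2 * length ks              ≡⟨ cong (λ l → 2 + 2 * l) (length-applyUpTo suc (i + j ∸ 1)) ⟩
    2 + 2 * (i + j ∸ 1)            ≡⟨ *-suc 2 (i + j ∸ 1) ⟨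
    2 * suc (i + j ∸ 1)            ≡⟨ cong (2 *_) (m+[n∸m]≡n (≤-trans 1≤j (m≤n+m j i))) ⟩
    2 * (i + j)                    ∎
    where
    open ≡-Reasoning
    L  = length (kids n i j)
    ks = applyUpTo suc (i + j ∸ 1)
    i-once : count (_≟ i) ks ≡ 1
    i-once = count-upTo-≤ (i + j ∸ 1) 1≤i (m≤m+n∸1 i 1≤j)

record Optimal (w : ℕ) (t : Tree ℕ) : Set where
  field
    minimal       : ∀ {t'} → shape t' ≡ shape t → Proper t' → colorSum t ≤ colorSum t'
    unique        : ∀ {t'} → shape t' ≡ shape t → Proper t' → colorSum t' ≡ colorSum t → t' ≡ t
    recolour-cost : ∀ {t'} → shape t' ≡ shape t → Proper t' → label t' ≢ label t → colorSum t + w ≤ colorSum t'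

module _ (W : ℕ → ℕ) where

  colorSums-minimal : ∀ {cs ts} → All (λ t → Optimal (W (label t)) t) cs → shapes ts ≡ shapes cs →
                      All Proper ts → colorSums cs ≤ colorSums ts
  colorSums-minimal {[]}    {[]}    []           _  []         = z≤n
  colorSums-minimal {_ ∷ _} {_ ∷ _} (opt ∷ opts) sh (pt ∷ pts) with ∷-injective sh
  ... | sh₁ , sh₂ = +-mono-≤ (Optimal.minimal opt sh₁ pt) (colorSums-minimal opts sh₂ pts)

  colorSums-unique : ∀ {cs ts} → All (λ t → Optimal (W (label t)) t) cs → shapes ts ≡ shapes cs →
                     All Proper ts → colorSums ts ≡ colorSums cs → ts ≡ cs
  colorSums-unique {[]}    {[]}    []           _  []         _ = refl
  colorSums-unique {_ ∷ _} {_ ∷ _} (opt ∷ opts) sh (pt ∷ pts) e with ∷-injective sh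
  ... | sh₁ , sh₂ with +-≤-tight (Optimal.minimal opt sh₁ pt) (colorSums-minimal opts sh₂ pts) e
  ... | e₁ , e₂ = cong₂ _∷_ (Optimal.unique opt sh₁ pt e₁) (colorSums-unique opts sh₂ pts e₂)

  colorSums-recoloured : ∀ x {cs ts} → All (λ t → Optimal (W (label t)) t) cs → shapes ts ≡ shapes cs →
                         All Proper ts → All (λ t → label t ≢ x) ts →
                         colorSums cs + count (λ t → label t ≟ x) cs * W x ≤ colorSums ts
  colorSums-recoloured x {[]}     {[]}     []           _  []         []          = z≤n
  colorSums-recoloured x {c ∷ cs} {t ∷ ts} (opt ∷ opts) sh (pt ∷ pts) (t≢x ∷ ts≢x) with ∷-injective sh
  ... | sh₁ , sh₂ with label c ≟ x
  ... | yes refl = begin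
    colorSum c + C + count P? (c ∷ cs) * W x  ≡⟨ cong (λ m → colorSum c + C + m * W x) (count-accept P? c cs refl) ⟩
    colorSum c + C + (W x + count P? cs * W x) ≡⟨ interchange (colorSum c) C (W x) _ ⟩
    colorSum c + W x + (C + count P? cs * W x) ≤⟨ +-mono-≤ (Optimal.recolour-cost opt sh₁ pt t≢x) rest ⟩
    colorSum t + colorSums ts                  ∎
    where
    open ≤-Reasoning
    P?   = λ t → label t ≟ x
    C    = colorSums cs
    rest : C + count P? cs * W x ≤ colorSums ts
    rest = colorSums-recoloured x opts sh₂ pts ts≢x
  ... | no c≢x = begin
    colorSum c + C + count P? (c ∷ cs) * W x  ≡⟨ cong (λ m → colorSum c + C + m * W x) (count-reject P? c cs c≢x) ⟩
    colorSum c + C + count P? cs * W x        ≡⟨ +-assoc (colorSum c) C _ ⟩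
    colorSum c + (C + count P? cs * W x)      ≤⟨ +-mono-≤ (Optimal.minimal opt sh₁ pt) rest ⟩
    colorSum t + colorSums ts                 ∎
    where
    open ≤-Reasoning
    P?   = λ t → label t ≟ x
    C    = colorSums cs
    rest : C + count P? cs * W x ≤ colorSums ts
    rest = colorSums-recoloured x opts sh₂ pts ts≢x

kids-recolouring-cost : ∀ {n i j c ts} → ChildIndex i j c →
                        All (λ t → Optimal (childSup i j (label t)) t) (kids n i j) →
                        shapes ts ≡ shapes (kids n i j) → All Proper ts → All (λ t → label t ≢ c) ts →
                        i + j + colorSums (kids n i j) ≤ c + colorSums ts
kids-recolouring-cost {n} {i} {j} {c} {ts} κ cs-optimal sh ts-proper ts≢c = begin
  i + j + X               ≡⟨ +-comm (i + j) X ⟩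
  X + (i + j)             ≤⟨ +-monoʳ-≤ X (child-sum-gap κ) ⟩
  X + (c + 2 * m)         ≤⟨ +-monoʳ-≤ X (+-monoʳ-≤ c (*-monoˡ-≤ m (count-kids κ))) ⟩
  X + (c + copies * m)    ≡⟨ x∙yz≈y∙xz X c _ ⟩
  c + (X + copies * m)    ≤⟨ +-monoʳ-≤ c (colorSums-recoloured (childSup i j) c cs-optimal sh ts-proper ts≢c) ⟩
  c + colorSums ts        ∎
  where
  open ≤-Reasoning
  X      = colorSums (kids n i j)
  m      = childSup i j c
  copies = count (λ t → label t ≟ c) (kids n i j)

build-optimal : ∀ n {i j} → Fueled n i j → Optimal j (build n i j)
build-optimal zero    φ = contradiction φ ¬Fueled-zero
build-optimal (suc n) {i} {j} φ = record { minimal = minimal ; unique = unique ; recolour-cost = recolour-cost }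
  where
  cs = kids n i j
  X  = colorSums cs

  cs-optimal : All (λ t → Optimal (childSup i j (label t)) t) cs
  cs-optimal = kids-All λ {k} κ →
    subst (λ l → Optimal (childSup i j l) (child n i j k)) (sym (label-build n k _))
          (build-optimal n (Fueled-child φ κ))

  cs-minimal : ∀ {ts} → shapes ts ≡ shapes cs → All Proper ts → X ≤ colorSums ts
  cs-minimal = colorSums-minimal (childSup i j) cs-optimal

  recolour-cost : ∀ {t'} → shape t' ≡ shape (build (suc n) i j) → Proper t' → label t' ≢ i →
                  i + X + j ≤ colorSum t'
  recolour-cost {node c ts} sh (node 1≤c ts≢c ts-proper) c≢i = begin
    i + X + j         ≡⟨ xy∙z≈xz∙y i X j ⟩
    i + j + X         ≤⟨ root-and-children (i + j ≤? c) ⟩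
    c + colorSums ts  ∎
    where
    open ≤-Reasoning
    root-and-children : Dec (i + j ≤ c) → i + j + X ≤ c + colorSums ts
    root-and-children (yes i+j≤c) = +-mono-≤ i+j≤c (cs-minimal (cong children sh) ts-proper)
    root-and-children (no i+j≰c)  = kids-recolouring-cost κ cs-optimal (cong children sh) ts-proper ts≢c
      where κ = record { 1≤k = 1≤c ; k<i+j = ≰⇒> i+j≰c ; k≢i = c≢i }

  minimal : ∀ {t'} → shape t' ≡ shape (build (suc n) i j) → Proper t' → i + X ≤ colorSum t'
  minimal {node c ts} sh pr@(node _ _ ts-proper) with c ≟ i
  ... | yes refl = +-monoʳ-≤ c (cs-minimal (cong children sh) ts-proper)
  ... | no c≢i   = ≤-trans (m≤m+n (i + X) j) (recolour-cost sh pr c≢i)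

  unique : ∀ {t'} → shape t' ≡ shape (build (suc n) i j) → Proper t' → colorSum t' ≡ i + X → t' ≡ node i cs
  unique {node c ts} sh pr@(node _ _ ts-proper) e with c ≟ i
  ... | yes refl = cong (node c) (colorSums-unique (childSup i j) cs-optimal (cong children sh) ts-proper
                                                   (+-cancelˡ-≡ c _ _ e))
  ... | no c≢i   = contradiction (≤-trans (recolour-cost sh pr c≢i) (≤-reflexive e))
                                 (<⇒≱ (m<m+n (i + X) (Fueled.1≤j φ)))

maxColors-lub : ∀ {ts b} → All (λ t → maxColor t ≤ b) ts → maxColors ts ≤ b
maxColors-lub []       = z≤n
maxColors-lub (p ∷ ps) = ⊔-lub p (maxColors-lub ps)

maxColor≤maxColors : ∀ {t ts} → t ∈ ts → maxColor t ≤ maxColors ts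
maxColor≤maxColors (here refl)  = m≤m⊔n _ _
maxColor≤maxColors (there t∈ts) = ≤-trans (maxColor≤maxColors t∈ts) (m≤n⊔m _ _)

label≤maxColor : ∀ t → label t ≤ maxColor t
label≤maxColor (node c _) = m≤m⊔n c _

maxColor-build : ∀ n {i j} → Fueled n i j → maxColor (build n i j) ≡ i + j ∸ 1
maxColor-build zero    φ = contradiction φ ¬Fueled-zero
maxColor-build (suc n) {i} {j} φ = ≤-antisym upper lower
  where
  open Fueled φ
  cs = kids n i j

  upper : i ⊔ maxColors cs ≤ i + j ∸ 1
  upper = ⊔-lub (m≤m+n∸1 i 1≤j) (maxColors-lub (kids-All λ κ →
    ≤-trans (≤-reflexive (maxColor-build n (Fueled-child φ κ))) (∸-monoˡ-≤ 1 (child-sum-≤ κ))))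

  lower : i + j ∸ 1 ≤ i ⊔ maxColors cs
  lower with m≤n⇒m<n∨m≡n 1≤j
  ... | inj₂ 1≡j = begin
    i + j ∸ 1         ≡⟨ cong (λ j → i + j ∸ 1) 1≡j ⟨
    i + 1 ∸ 1         ≡⟨ m+n∸n≡m i 1 ⟩
    i                 ≤⟨ m≤m⊔n i _ ⟩
    i ⊔ maxColors cs  ∎
    where open ≤-Reasoning
  ... | inj₁ 2≤j = begin
    i + j ∸ 1         ≡⟨ label-build n (i + j ∸ 1) _ ⟨
    label last        ≤⟨ label≤maxColor last ⟩
    maxColor last     ≤⟨ maxColor≤maxColors (kids-∈ {n} {i} {j} (lastChild 2≤j)) ⟩
    maxColors cs      ≤⟨ m≤n⊔m i _ ⟩
    i ⊔ maxColors cs  ∎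
    where
    open ≤-Reasoning
    last = child n i j (i + j ∸ 1)

maxDegBelows-lub : ∀ {A : Set} {ts : List (Tree A)} {b} → All (λ t → maxDegBelow t ≤ b) ts → maxDegBelows ts ≤ b
maxDegBelows-lub []       = z≤n
maxDegBelows-lub (p ∷ ps) = ⊔-lub p (maxDegBelows-lub ps)

maxDegBelow≤maxDegBelows : ∀ {A : Set} {t : Tree A} {ts} → t ∈ ts → maxDegBelow t ≤ maxDegBelows ts
maxDegBelow≤maxDegBelows (here refl)  = m≤m⊔n _ _
maxDegBelow≤maxDegBelows (there t∈ts) = ≤-trans (maxDegBelow≤maxDegBelows t∈ts) (m≤n⊔m _ _)

length-shapes : ∀ {A : Set} (ts : List (Tree A)) → length (shapes ts) ≡ length ts
length-shapes []       = refl
length-shapes (t ∷ ts) = cong suc (length-shapes ts)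

mutual
  maxDegBelow-shape : ∀ {A : Set} (t : Tree A) → maxDegBelow (shape t) ≡ maxDegBelow t
  maxDegBelow-shape (node _ ts) = cong₂ (λ l d → suc l ⊔ d) (length-shapes ts) (maxDegBelows-shapes ts)

  maxDegBelows-shapes : ∀ {A : Set} (ts : List (Tree A)) → maxDegBelows (shapes ts) ≡ maxDegBelows ts
  maxDegBelows-shapes []       = refl
  maxDegBelows-shapes (t ∷ ts) = cong₂ _⊔_ (maxDegBelow-shape t) (maxDegBelows-shapes ts)

Δ-shape : ∀ {A : Set} (t : Tree A) → Δ (shape t) ≡ Δ t
Δ-shape (node _ ts) = cong₂ _⊔_ (length-shapes ts) (maxDegBelows-shapes ts)

rootDegree-shape : ∀ {A : Set} (t : Tree A) → rootDegree (shape t) ≡ rootDegree t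
rootDegree-shape (node _ ts) = length-shapes ts

maxDegBelow-build : ∀ n {i j} → Fueled n i j → 3 + maxDegBelow (build n i j) ≡ 2 * (i + j)
maxDegBelow-build zero    φ = contradiction φ ¬Fueled-zero
maxDegBelow-build (suc n) {i} {j} φ = begin-equality
  3 + (suc L ⊔ maxDegBelows cs)  ≡⟨ cong (3 +_) (m≥n⇒m⊔n≡m children-≤) ⟩
  4 + L                          ≡⟨ length-kids 1≤i 1≤j ⟩
  2 * (i + j)                    ∎
  where
  open ≤-Reasoning
  open Fueled φ
  cs = kids n i j
  L  = length cs

  children-≤ : maxDegBelows cs ≤ suc L
  children-≤ = maxDegBelows-lub (kids-All λ {k} κ → +-cancelˡ-≤ 3 _ _ (begin
    3 + maxDegBelow (child n i j k)  ≡⟨ maxDegBelow-build n (Fueled-child φ κ) ⟩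
    2 * (k + childSup i j k)         ≤⟨ *-monoʳ-≤ 2 (child-sum-≤ κ) ⟩
    2 * (i + j)                      ≡⟨ length-kids 1≤i 1≤j ⟨
    4 + L                            ∎))

Δ-build-j≡1 : ∀ n {i} → Fueled n i 1 →
              Δ (build n i 1) ≡ 2 * i ∸ 2 × rootDegree (build n i 1) ≡ Δ (build n i 1)
Δ-build-j≡1 zero    φ = contradiction φ ¬Fueled-zero
Δ-build-j≡1 (suc n) {i} φ = trans Δ≡L L≡2i∸2 , sym Δ≡L
  where
  open ≤-Reasoning
  open Fueled φ
  cs = kids n i 1
  L  = length cs

  2+L≡2i : 2 + L ≡ 2 * i
  2+L≡2i = +-cancelˡ-≡ 2 (2 + L) (2 * i) (begin-equality
    4 + L        ≡⟨ length-kids 1≤i 1≤j ⟩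
    2 * (i + 1)  ≡⟨ *-distribˡ-+ 2 i 1 ⟩
    2 * i + 2    ≡⟨ +-comm (2 * i) 2 ⟩
    2 + 2 * i    ∎)

  children-≤ : maxDegBelows cs ≤ L
  children-≤ = maxDegBelows-lub (kids-All λ {k} κ → +-cancelˡ-≤ 3 _ _ (begin
    3 + maxDegBelow (child n i 1 k)  ≡⟨ maxDegBelow-build n (Fueled-child φ κ) ⟩
    2 * (k + childSup i 1 k)         ≤⟨ *-monoʳ-≤ 2 (child-sum-≤-when-j≡1 κ) ⟩
    2 * i                            ≡⟨ 2+L≡2i ⟨
    2 + L                            ≤⟨ n≤1+n (2 + L) ⟩
    3 + L                            ∎))

  Δ≡L : Δ (build (suc n) i 1) ≡ L
  Δ≡L = m≥n⇒m⊔n≡m children-≤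

  L≡2i∸2 : L ≡ 2 * i ∸ 2
  L≡2i∸2 = trans (sym (m+n∸m≡n 2 L)) (cong (_∸ 2) 2+L≡2i)

Δ-build-2≤j : ∀ n {i j} → Fueled n i j → 2 ≤ j → Δ (build n i j) ≡ 2 * (i + j) ∸ 3
Δ-build-2≤j zero    φ _ = contradiction φ ¬Fueled-zero
Δ-build-2≤j (suc n) {i} {j} φ 2≤j = begin-equality
  L ⊔ maxDegBelows cs  ≡⟨ cong (L ⊔_) (≤-antisym children-≤ last-≥) ⟩
  L ⊔ suc L            ≡⟨ m≤n⇒m⊔n≡n (n≤1+n L) ⟩
  suc L                ≡⟨ m+n∸m≡n 3 (suc L) ⟨
  4 + L ∸ 3            ≡⟨ cong (_∸ 3) (length-kids 1≤i 1≤j) ⟩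
  2 * (i + j) ∸ 3      ∎
  where
  open ≤-Reasoning
  open Fueled φ
  cs = kids n i j
  L  = length cs
  k  = i + j ∸ 1

  children-≤ : maxDegBelows cs ≤ suc L
  children-≤ = m⊔n≤o⇒n≤o (suc L) _ (≤-reflexive (+-cancelˡ-≡ 3 _ _
    (trans (maxDegBelow-build (suc n) φ) (sym (length-kids 1≤i 1≤j)))))

  last-≥ : suc L ≤ maxDegBelows cs
  last-≥ = ≤-trans (+-cancelˡ-≤ 3 _ _ (begin
    4 + L                            ≡⟨ length-kids 1≤i 1≤j ⟩
    2 * (i + j)                      ≤⟨ *-monoʳ-≤ 2 (lastChild-sum {i} 2≤j) ⟩
    2 * (k + childSup i j k)         ≡⟨ maxDegBelow-build n (Fueled-child φ (lastChild 2≤j)) ⟨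
    3 + maxDegBelow (child n i j k)  ∎))
    (maxDegBelow≤maxDegBelows (kids-∈ {n} {i} {j} (lastChild 2≤j)))

mainTheorem2 : (i j : ℕ) → 1 ≤ i → 1 ≤ j →
      ((f' : Tree ℕ) → shape f' ≡ T i j → Proper f' → f' ≢ f i j →
          colorSum (f i j) < colorSum f')
    × ((f' : Tree ℕ) → shape f' ≡ T i j → Proper f' → label f' ≢ i →
          colorSum (f i j) + j ≤ colorSum f')
    × (j ≡ 1 → Δ (T i j) ≡ 2 * i ∸ 2 × rootDegree (T i j) ≡ Δ (T i j))
    × (2 ≤ j → Δ (T i j) ≡ 2 * (i + j) ∸ 3)
    × (maxColor (f i j) ≡ i + j ∸ 1)
mainTheorem2 i j 1≤i 1≤j =
    (λ f' sh pr f'≢f → ≤∧≢⇒< (minimal sh pr) (f'≢f ∘ unique sh pr ∘ sym))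
  , (λ f' sh pr root≢i → recolour-cost sh pr (root≢i ∘ flip trans (label-build (fuel i j) i j)))
  , (λ { refl → let (Δ≡ , root≡Δ) = Δ-build-j≡1 (fuel i 1) φ in
                 trans (Δ-shape (f i 1)) Δ≡
               , trans (rootDegree-shape (f i 1)) (trans root≡Δ (sym (Δ-shape (f i 1)))) })
  , (λ 2≤j → trans (Δ-shape (f i j)) (Δ-build-2≤j (fuel i j) φ 2≤j))
  , maxColor-build (fuel i j) φ
  where
  φ : Fueled (fuel i j) i j
  φ = record { 1≤i = 1≤i ; 1≤j = 1≤j ; enough = ≤-refl }
  open Optimal (build-optimal (fuel i j) φ)
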